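{- Let $r,s,M,N$ be integers with $r,M,N>0$. Then \[ u_{rM}\sum_{i=1}^{N}\frac{q^{ri}}{w_{ri+s}\,w_{r(i+M)+s}}=u_{rN}\sum_{i=1}^{M}\frac{q^{ri}}{w_{ri+s}\,w_{r(i+N)+s}}, \] and, for either choice of sign (the same on both sides), \[ u_{2rM}\sum_{i=1}^{2N}\frac{(\pm1)^i q^{ri}}{w_{ri+s}\,w_{r(i+2M)+s}}=u_{2rN}\sum_{i=1}^{2M}\frac{(\pm1)^i q^{ri}}{w_{ri+s}\,w_{r(i+2N)+s}}. \]
   Context: Let $a,b,p,q$ be complex numbers. The generalized Lucas sequence $w_n=w_n(a,b;p,q)$ is defined by $w_0=a$, $w_1=b$, $w_n=pw_{n-1}-qw_{n-2}$, and the Lucas sequence of the first kind is $u_n=u_n(p,q)=w_n(0,1;p,q)$. Let $\alpha,\beta$ be the roots of $x^2-px+q=0$, labeled so that $|\alpha|>|\beta|$, with discriminant $D=p^2-4q\neq 0$; thus $\alpha+\beta=p$, $\alpha\beta=q$, $\alpha-\beta=\sqrt D$. With $A=b-a\beta$ and $B=b-a\alpha$ one has the Binet formulas $w_n=(A\alpha^n-B\beta^n)/(\alpha-\beta)$ and $u_n=(\alpha^n-\beta^n)/(\alpha-\beta)$; these formulas also define $w_n,u_n$ for negative integers $n$ (with $q\neq0$ understood whenever negative indices occur). As implicit in the statement, all denominators appearing are assumed nonzero. -}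

module Defs where

open import Level using (Level; _⊔_; suc)
open import Algebra.Bundles using (CommutativeRing)
open import Data.Nat as ℕ using (ℕ; zero)
import Data.Nat as N
open import Data.Integer as ℤ using (ℤ; +_; -[1+_])
open import Relation.Nullary using (¬_)

-- A field: a commutative ring with 0 ≠ 1 and a (total) inverse operation
-- which is a two-sided inverse on nonzero elements (the value at 0 is irrelevant).
record Field (c ℓ : Level) : Set (Level.suc (c ⊔ ℓ)) where
  field
    commutativeRing : CommutativeRing c ℓ
  open CommutativeRing commutativeRing public
  field
    _⁻¹      : Carrier → Carrier
    0≉1      : ¬ (0# ≈ 1#)
    ⁻¹-inverse : ∀ x → ¬ (x ≈ 0#) → x * (x ⁻¹) ≈ 1#

module FieldOps {c ℓ : Level} (F : Field c ℓ) where
  open Field F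

  infixl 7 _/_
  _/_ : Carrier → Carrier → Carrier
  x / y = x * (y ⁻¹)

  _^ℕ_ : Carrier → ℕ → Carrier
  x ^ℕ zero = 1#
  x ^ℕ N.suc n = x * (x ^ℕ n)

  sum1 : ℕ → (ℕ → Carrier) → Carrier
  sum1 zero f = 0#
  sum1 (N.suc n) f = sum1 n f + f (N.suc n)

  open import Data.Product using (_×_; _,_; proj₁; proj₂)

  -- Generalized Lucas sequence w_n(a,b;p,q):
  --   w₀ = a, w₁ = b, w_n = p w_{n-1} - q w_{n-2},
  -- extended to negative indices by running the recurrence backwards,
  --   w_{n-2} = (p w_{n-1} - w_n) / q   (meaningful when q ≠ 0),
  -- which agrees with the Binet formula on negative indices.
  -- wFwd n = (w_n , w_{n+1})
  wFwd : (a b p q : Carrier) → ℕ → Carrier × Carrier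
  wFwd a b p q zero = a , b
  wFwd a b p q (N.suc n) with wFwd a b p q n
  ... | x , y = y , (p * y - q * x)

  -- wBwd k = (w_{-k} , w_{-k+1})
  wBwd : (a b p q : Carrier) → ℕ → Carrier × Carrier
  wBwd a b p q zero = a , b
  wBwd a b p q (N.suc k) with wBwd a b p q k
  ... | x , y = (p * x - y) / q , x

  w : (a b p q : Carrier) → ℤ → Carrier
  w a b p q (+ n) = proj₁ (wFwd a b p q n)
  w a b p q -[1+ k ] = proj₁ (wBwd a b p q (N.suc k))

  u : (p q : Carrier) → ℤ → Carrier
  u p q n = w 0# 1# p q n

  disc : (p q : Carrier) → Carrier
  disc p q = p * p - (1# + 1# + 1# + 1#) * q

-- For every solution W of W_{n+2} = p W_{n+1} - q W_n the Casoratian identity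
-- u_{k+n} W_n - u_n W_{k+n} = W_0 q^n u_k holds, i.e.
-- W_0 u_k q^n / (W_n W_{k+n}) = u_{k+n} / W_{k+n} - u_n / W_n.
-- Taking W_j = w_{r+s+j}, k = rM and n = r(i-1) turns each side of the first identity
-- into (q^r / W_0) times a telescoping sum  Σ_{i=1}^{N} (G_{i+M} - G_i), and
-- Σ_{i=1}^{N} (G_{i+M} - G_i) = Σ_{i=1}^{N+M} G_i - Σ_{i=1}^{M} G_i - Σ_{i=1}^{N} G_i
-- is symmetric in M and N.  For the alternating identity, ε^{2M} = 1 lets ε^i G_i
-- play the role of G_i.
module Submission where

open import Defs
open import Level using (Level)
open import Algebra.Bundles using (CommutativeRing)
open import Algebra.Solver.Ring.AlmostCommutativeRing
  using (fromCommutativeRing; _-Raw-AlmostCommutative⟶_)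
open import Data.Nat as ℕ using (ℕ; zero; suc; _≤_; s≤s; z≤n)
import Data.Nat.Properties as ℕP
open import Data.Integer as ℤ using (ℤ; +_; -[1+_])
import Data.Integer.Properties as ℤP
import Data.Sign as Sign
open import Data.Maybe using (Maybe; just; nothing)
open import Data.Product using (_×_; _,_; proj₁)
open import Data.Sum using (_⊎_; inj₁; inj₂)
open import Relation.Nullary using (¬_; yes; no)
open import Relation.Binary.PropositionalEquality as ≡ using (_≡_)

-- The ring solver for an arbitrary commutative ring, with integer coefficients
-- (through the canonical map ℤ → R) so that x - x normalises to 0.
module IntegerCoefficientSolver {c ℓ : Level} (R : CommutativeRing c ℓ) where
  open CommutativeRing R
  open import Algebra.Properties.Ring ring using (-‿distribˡ-*; -‿distribʳ-*)
  open import Algebra.Properties.AbelianGroup +-abelianGroup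
    using (ε⁻¹≈ε; ⁻¹-involutive; ⁻¹-∙-comm)
  open import Algebra.Properties.Semiring.Mult.TCOptimised semiring
    using (1+×; ×-homo-+; ×1-homo-*)
    renaming (_×_ to _×ᴿ_)
  open import Relation.Binary.Reasoning.Setoid setoid

  fromℤ : ℤ → Carrier
  fromℤ (+ n)      = n ×ᴿ 1#
  fromℤ -[1+ n ] = - (suc n ×ᴿ 1#)

  [x+y]-[x+z]≈y-z : ∀ x y z → (x + y) - (x + z) ≈ y - z
  [x+y]-[x+z]≈y-z x y z = begin
    (x + y) + - (x + z)   ≈⟨ +-congˡ (⁻¹-∙-comm x z) ⟨
    (x + y) + (- x + - z) ≈⟨ +-assoc x y _ ⟩
    x + (y + (- x + - z)) ≈⟨ +-congˡ (+-assoc y (- x) (- z)) ⟨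
    x + ((y + - x) + - z) ≈⟨ +-congˡ (+-congʳ (+-comm y (- x))) ⟩
    x + ((- x + y) + - z) ≈⟨ +-congˡ (+-assoc (- x) y (- z)) ⟩
    x + (- x + (y - z))   ≈⟨ +-assoc x (- x) _ ⟨
    (x + - x) + (y - z)   ≈⟨ +-congʳ (-‿inverseʳ x) ⟩
    0# + (y - z)          ≈⟨ +-identityˡ _ ⟩
    y - z                 ∎

  fromℤ-⊖ : ∀ m n → fromℤ (m ℤ.⊖ n) ≈ m ×ᴿ 1# - n ×ᴿ 1#
  fromℤ-⊖ zero    zero    = sym (-‿inverseʳ 0#)
  fromℤ-⊖ zero    (suc n) = sym (+-identityˡ _)
  fromℤ-⊖ (suc m) zero    = sym (trans (+-congˡ ε⁻¹≈ε) (+-identityʳ _))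
  fromℤ-⊖ (suc m) (suc n) = begin
    fromℤ (suc m ℤ.⊖ suc n)                 ≡⟨ ≡.cong fromℤ (ℤP.[1+m]⊖[1+n]≡m⊖n m n) ⟩
    fromℤ (m ℤ.⊖ n)                         ≈⟨ fromℤ-⊖ m n ⟩
    m ×ᴿ 1# - n ×ᴿ 1#                     ≈⟨ [x+y]-[x+z]≈y-z 1# _ _ ⟨
    (1# + m ×ᴿ 1#) - (1# + n ×ᴿ 1#)       ≈⟨ +-cong (1+× m 1#) (-‿cong (1+× n 1#)) ⟨
    suc m ×ᴿ 1# - suc n ×ᴿ 1#             ∎

  fromℤ-+ : ∀ i j → fromℤ (i ℤ.+ j) ≈ fromℤ (i) + fromℤ (j)
  fromℤ-+ (+ m)      (+ n)      = ×-homo-+ 1# m n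
  fromℤ-+ (+ m)      -[1+ n ]   = fromℤ-⊖ m (suc n)
  fromℤ-+ -[1+ m ]   (+ n)      = trans (fromℤ-⊖ n (suc m)) (+-comm _ _)
  fromℤ-+ -[1+ m ]   -[1+ n ]   = begin
    - (suc (suc (m ℕ.+ n)) ×ᴿ 1#)    ≡⟨ ≡.cong (λ k → - (suc k ×ᴿ 1#)) (ℕP.+-suc m n) ⟨
    - ((suc m ℕ.+ suc n) ×ᴿ 1#)      ≈⟨ -‿cong (×-homo-+ 1# (suc m) (suc n)) ⟩
    - (suc m ×ᴿ 1# + suc n ×ᴿ 1#)     ≈⟨ ⁻¹-∙-comm _ _ ⟨
    - (suc m ×ᴿ 1#) + - (suc n ×ᴿ 1#) ∎

  fromℤ-neg : ∀ i → fromℤ (ℤ.- i) ≈ - fromℤ (i)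
  fromℤ-neg (+ zero)  = sym ε⁻¹≈ε
  fromℤ-neg (+ suc n) = refl
  fromℤ-neg -[1+ n ]  = sym (⁻¹-involutive _)

  fromℤ-◃⁺ : ∀ n → fromℤ (Sign.+ ℤ.◃ n) ≈ n ×ᴿ 1#
  fromℤ-◃⁺ zero    = refl
  fromℤ-◃⁺ (suc n) = refl

  fromℤ-◃⁻ : ∀ n → fromℤ (Sign.- ℤ.◃ n) ≈ - (n ×ᴿ 1#)
  fromℤ-◃⁻ zero    = sym ε⁻¹≈ε
  fromℤ-◃⁻ (suc n) = refl

  fromℤ-* : ∀ i j → fromℤ (i ℤ.* j) ≈ fromℤ (i) * fromℤ (j)
  fromℤ-* (+ m)    (+ n)    = trans (fromℤ-◃⁺ (m ℕ.* n)) (×1-homo-* m n)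
  fromℤ-* (+ m)    -[1+ n ] = begin
    fromℤ (Sign.- ℤ.◃ (m ℕ.* suc n)) ≈⟨ fromℤ-◃⁻ (m ℕ.* suc n) ⟩
    - ((m ℕ.* suc n) ×ᴿ 1#)       ≈⟨ -‿cong (×1-homo-* m (suc n)) ⟩
    - (m ×ᴿ 1# * suc n ×ᴿ 1#)      ≈⟨ -‿distribʳ-* _ _ ⟩
    m ×ᴿ 1# * - (suc n ×ᴿ 1#)      ∎
  fromℤ-* -[1+ m ] (+ n)    = begin
    fromℤ (Sign.- ℤ.◃ (suc m ℕ.* n)) ≈⟨ fromℤ-◃⁻ (suc m ℕ.* n) ⟩
    - ((suc m ℕ.* n) ×ᴿ 1#)       ≈⟨ -‿cong (×1-homo-* (suc m) n) ⟩
    - (suc m ×ᴿ 1# * n ×ᴿ 1#)      ≈⟨ -‿distribˡ-* _ _ ⟩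
    - (suc m ×ᴿ 1#) * n ×ᴿ 1#      ∎
  fromℤ-* -[1+ m ] -[1+ n ] = begin
    fromℤ (Sign.+ ℤ.◃ (suc m ℕ.* suc n))     ≈⟨ fromℤ-◃⁺ (suc m ℕ.* suc n) ⟩
    (suc m ℕ.* suc n) ×ᴿ 1#               ≈⟨ ×1-homo-* (suc m) (suc n) ⟩
    suc m ×ᴿ 1# * suc n ×ᴿ 1#              ≈⟨ ⁻¹-involutive _ ⟨
    - (- (suc m ×ᴿ 1# * suc n ×ᴿ 1#))      ≈⟨ -‿cong (-‿distribˡ-* _ _) ⟩
    - (- (suc m ×ᴿ 1#) * suc n ×ᴿ 1#)      ≈⟨ -‿distribʳ-* _ _ ⟩
    - (suc m ×ᴿ 1#) * - (suc n ×ᴿ 1#)      ∎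

  homomorphism : ℤ.+-*-rawRing -Raw-AlmostCommutative⟶ fromCommutativeRing R
  homomorphism = record
    { ⟦_⟧    = fromℤ
    ; +-homo = fromℤ-+
    ; *-homo = fromℤ-*
    ; -‿homo = fromℤ-neg
    ; 0-homo = refl
    ; 1-homo = refl
    }

  fromℤ-equal? : ∀ i j → Maybe (fromℤ (i) ≈ fromℤ (j))
  fromℤ-equal? i j with i ℤ.≟ j
  ... | yes i≡j = just (reflexive (≡.cong fromℤ i≡j))
  ... | no _    = nothing

  open import Algebra.Solver.Ring ℤ.+-*-rawRing (fromCommutativeRing R) homomorphism fromℤ-equal? public

module FieldProperties {c ℓ : Level} (F : Field c ℓ) where
  open Field F
  open FieldOps F
  open IntegerCoefficientSolver commutativeRing using (solve; _:=_; _:+_; _:*_; :-_; _:-_; con)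
  open import Relation.Binary.Reasoning.Setoid setoid

  [x*y]/x≈y : ∀ {x} → ¬ (x ≈ 0#) → ∀ y → (x * y) / x ≈ y
  [x*y]/x≈y {x} x≉0 y = begin
    (x * y) * x ⁻¹ ≈⟨ solve 3 (λ x y x⁻¹ → (x :* y) :* x⁻¹ := (x :* x⁻¹) :* y) refl x y (x ⁻¹) ⟩
    (x * x ⁻¹) * y ≈⟨ *-congʳ (⁻¹-inverse x x≉0) ⟩
    1# * y         ≈⟨ *-identityˡ y ⟩
    y              ∎

  x*[y/x]≈y : ∀ {x} → ¬ (x ≈ 0#) → ∀ y → x * (y / x) ≈ y
  x*[y/x]≈y {x} x≉0 y = trans (sym (*-assoc x y (x ⁻¹))) ([x*y]/x≈y x≉0 y)

  *-cancelˡ : ∀ {x y z} → ¬ (x ≈ 0#) → x * y ≈ x * z → y ≈ z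
  *-cancelˡ {x} {y} {z} x≉0 xy≈xz = begin
    y              ≈⟨ [x*y]/x≈y x≉0 y ⟨
    (x * y) / x    ≈⟨ *-congʳ xy≈xz ⟩
    (x * z) / x    ≈⟨ [x*y]/x≈y x≉0 z ⟩
    z              ∎

  *-nonzero : ∀ {x y} → ¬ (x ≈ 0#) → ¬ (y ≈ 0#) → ¬ (x * y ≈ 0#)
  *-nonzero {x} {y} x≉0 y≉0 xy≈0 = y≉0 (begin
    y              ≈⟨ [x*y]/x≈y x≉0 y ⟨
    (x * y) / x    ≈⟨ *-congʳ xy≈0 ⟩
    0# * x ⁻¹      ≈⟨ zeroˡ (x ⁻¹) ⟩
    0#             ∎)

  ⁻¹-distrib-* : ∀ {x y} → ¬ (x ≈ 0#) → ¬ (y ≈ 0#) → (x * y) ⁻¹ ≈ x ⁻¹ * y ⁻¹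
  ⁻¹-distrib-* {x} {y} x≉0 y≉0 = *-cancelˡ (*-nonzero x≉0 y≉0) (begin
    (x * y) * (x * y) ⁻¹     ≈⟨ ⁻¹-inverse (x * y) (*-nonzero x≉0 y≉0) ⟩
    1#                       ≈⟨ *-identityˡ 1# ⟨
    1# * 1#                  ≈⟨ *-cong (⁻¹-inverse x x≉0) (⁻¹-inverse y y≉0) ⟨
    (x * x ⁻¹) * (y * y ⁻¹)  ≈⟨ solve 4 (λ x y x⁻¹ y⁻¹ → (x :* x⁻¹) :* (y :* y⁻¹)
                                                        := (x :* y) :* (x⁻¹ :* y⁻¹))
                                  refl x y (x ⁻¹) (y ⁻¹) ⟩
    (x * y) * (x ⁻¹ * y ⁻¹)  ∎)

  /-difference : ∀ {x y} → ¬ (x ≈ 0#) → ¬ (y ≈ 0#) → ∀ a b → a / y - b / x ≈ (a * x - b * y) / (x * y)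
  /-difference {x} {y} x≉0 y≉0 a b = begin
    a * y ⁻¹ - b * x ⁻¹
      ≈⟨ solve 4 (λ a b x⁻¹ y⁻¹ → a :* y⁻¹ :- b :* x⁻¹ := a :* con (+ 1) :* y⁻¹ :- b :* con (+ 1) :* x⁻¹)
           refl a b (x ⁻¹) (y ⁻¹) ⟩
    a * 1# * y ⁻¹ - b * 1# * x ⁻¹
      ≈⟨ +-cong (*-congʳ (*-congˡ (⁻¹-inverse x x≉0))) (-‿cong (*-congʳ (*-congˡ (⁻¹-inverse y y≉0)))) ⟨
    a * (x * x ⁻¹) * y ⁻¹ - b * (y * y ⁻¹) * x ⁻¹
      ≈⟨ solve 6 (λ a b x y x⁻¹ y⁻¹ → a :* (x :* x⁻¹) :* y⁻¹ :- b :* (y :* y⁻¹) :* x⁻¹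
                                       := (a :* x :- b :* y) :* (x⁻¹ :* y⁻¹))
           refl a b x y (x ⁻¹) (y ⁻¹) ⟩
    (a * x - b * y) * (x ⁻¹ * y ⁻¹)
      ≈⟨ *-congˡ (⁻¹-distrib-* x≉0 y≉0) ⟨
    (a * x - b * y) / (x * y)
      ∎

  ^ℕ-+ : ∀ x m n → x ^ℕ (m ℕ.+ n) ≈ x ^ℕ m * x ^ℕ n
  ^ℕ-+ x zero    n = sym (*-identityˡ _)
  ^ℕ-+ x (suc m) n = trans (*-congˡ (^ℕ-+ x m n)) (sym (*-assoc _ _ _))

  ±1-square : ∀ {x} → x ≈ 1# ⊎ x ≈ - 1# → x * x ≈ 1#
  ±1-square (inj₁ x≈1)  = trans (*-cong x≈1 x≈1) (*-identityˡ 1#)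
  ±1-square (inj₂ x≈-1) = trans (*-cong x≈-1 x≈-1) (solve 0 ((:- con (+ 1)) :* (:- con (+ 1)) := con (+ 1)) refl)

  ^ℕ-even : ∀ {x} → x * x ≈ 1# → ∀ n → x ^ℕ (2 ℕ.* n) ≈ 1#
  ^ℕ-even x²≈1 zero    = refl
  ^ℕ-even {x} x²≈1 (suc n) = begin
    x ^ℕ (2 ℕ.* suc n)        ≡⟨ ≡.cong (x ^ℕ_) (ℕP.*-suc 2 n) ⟩
    x * (x * x ^ℕ (2 ℕ.* n))  ≈⟨ *-assoc x x _ ⟨
    (x * x) * x ^ℕ (2 ℕ.* n)  ≈⟨ *-cong x²≈1 (^ℕ-even x²≈1 n) ⟩
    1# * 1#                   ≈⟨ *-identityˡ 1# ⟩
    1#                        ∎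

  ^ℕ-+-even : ∀ {x} → x * x ≈ 1# → ∀ m n → x ^ℕ (m ℕ.+ 2 ℕ.* n) ≈ x ^ℕ m
  ^ℕ-+-even {x} x²≈1 m n = trans (^ℕ-+ x m (2 ℕ.* n)) (trans (*-congˡ (^ℕ-even x²≈1 n)) (*-identityʳ _))

  sum1-cong : ∀ n {f g : ℕ → Carrier} → (∀ i → 1 ≤ i → i ≤ n → f i ≈ g i) → sum1 n f ≈ sum1 n g
  sum1-cong zero    f≈g = refl
  sum1-cong (suc n) f≈g =
    +-cong (sum1-cong n (λ i 1≤i i≤n → f≈g i 1≤i (ℕP.m≤n⇒m≤1+n i≤n))) (f≈g (suc n) (s≤s z≤n) ℕP.≤-refl)

  *-distribˡ-sum1 : ∀ x n (f : ℕ → Carrier) → x * sum1 n f ≈ sum1 n (λ i → x * f i)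
  *-distribˡ-sum1 x zero    f = zeroʳ x
  *-distribˡ-sum1 x (suc n) f = trans (distribˡ x _ _) (+-congʳ (*-distribˡ-sum1 x n f))

  sum1-telescope : ∀ (G : ℕ → Carrier) m n →
    sum1 n (λ i → G (i ℕ.+ m) - G i) ≈ (sum1 (n ℕ.+ m) G - sum1 m G) - sum1 n G
  sum1-telescope G m zero    = solve 1 (λ a → con (+ 0) := (a :- a) :- con (+ 0)) refl (sum1 m G)
  sum1-telescope G m (suc n) = begin
    sum1 n (λ i → G (i ℕ.+ m) - G i) + (G (suc n ℕ.+ m) - G (suc n))
      ≈⟨ +-congʳ (sum1-telescope G m n) ⟩
    ((sum1 (n ℕ.+ m) G - sum1 m G) - sum1 n G) + (G (suc n ℕ.+ m) - G (suc n))
      ≈⟨ solve 5 (λ a b c d e → ((a :- b) :- c) :+ (d :- e) := ((a :+ d) :- b) :- (c :+ e))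
           refl (sum1 (n ℕ.+ m) G) (sum1 m G) (sum1 n G) (G (suc n ℕ.+ m)) (G (suc n)) ⟩
    ((sum1 (n ℕ.+ m) G + G (suc n ℕ.+ m)) - sum1 m G) - (sum1 n G + G (suc n)) ∎

  sum1-telescope-comm : ∀ (G : ℕ → Carrier) m n →
    sum1 n (λ i → G (i ℕ.+ m) - G i) ≈ sum1 m (λ i → G (i ℕ.+ n) - G i)
  sum1-telescope-comm G m n = begin
    sum1 n (λ i → G (i ℕ.+ m) - G i)          ≈⟨ sum1-telescope G m n ⟩
    (sum1 (n ℕ.+ m) G - sum1 m G) - sum1 n G  ≡⟨ ≡.cong (λ k → (sum1 k G - sum1 m G) - sum1 n G) (ℕP.+-comm n m) ⟩
    (sum1 (m ℕ.+ n) G - sum1 m G) - sum1 n G  ≈⟨ solve 3 (λ a b c → (a :- b) :- c := (a :- c) :- b)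
                                                   refl (sum1 (m ℕ.+ n) G) (sum1 m G) (sum1 n G) ⟩
    (sum1 (m ℕ.+ n) G - sum1 n G) - sum1 m G  ≈⟨ sum1-telescope G n m ⟨
    sum1 m (λ i → G (i ℕ.+ n) - G i)          ∎

  sum1-scaled-cong : ∀ {a b k} n {f g : ℕ → Carrier} →
    (∀ i → 1 ≤ i → i ≤ n → a * (k * f i) ≈ b * g i) → a * (k * sum1 n f) ≈ b * sum1 n g
  sum1-scaled-cong {a} {b} {k} n {f} {g} termwise = begin
    a * (k * sum1 n f)               ≈⟨ *-congˡ (*-distribˡ-sum1 k n f) ⟩
    a * sum1 n (λ i → k * f i)       ≈⟨ *-distribˡ-sum1 a n _ ⟩
    sum1 n (λ i → a * (k * f i))     ≈⟨ sum1-cong n termwise ⟩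
    sum1 n (λ i → b * g i)           ≈⟨ *-distribˡ-sum1 b n g ⟨
    b * sum1 n g                     ∎

  telescoping-sums-agree : ∀ {a d k k′} m n {f f′ : ℕ → Carrier} (G : ℕ → Carrier) → ¬ (a ≈ 0#) →
    (∀ i → 1 ≤ i → i ≤ n → a * (k * f i) ≈ d * (G (i ℕ.+ m) - G i)) →
    (∀ i → 1 ≤ i → i ≤ m → a * (k′ * f′ i) ≈ d * (G (i ℕ.+ n) - G i)) →
    k * sum1 n f ≈ k′ * sum1 m f′
  telescoping-sums-agree {a} {d} {k} {k′} m n {f} {f′} G a≉0 f-telescopes f′-telescopes =
    *-cancelˡ a≉0 (begin
      a * (k * sum1 n f)                   ≈⟨ sum1-scaled-cong n f-telescopes ⟩
      d * sum1 n (λ i → G (i ℕ.+ m) - G i) ≈⟨ *-congˡ (sum1-telescope-comm G m n) ⟩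
      d * sum1 m (λ i → G (i ℕ.+ n) - G i) ≈⟨ sum1-scaled-cong m f′-telescopes ⟨
      a * (k′ * sum1 m f′)                 ∎)

module LucasRecurrence {c ℓ : Level} (F : Field c ℓ) (p q : Field.Carrier F) where
  open Field F
  open FieldOps F
  open FieldProperties F using (/-difference)
  open IntegerCoefficientSolver commutativeRing using (solve; _:=_; _:*_; _:-_; con)
  open import Relation.Binary.Reasoning.Setoid setoid

  Solution : (ℕ → Carrier) → Set ℓ
  Solution X = ∀ j → X (suc (suc j)) ≈ p * X (suc j) - q * X j

  solution-unique : ∀ {X Y} → Solution X → Solution Y → X 0 ≈ Y 0 → X 1 ≈ Y 1 → ∀ j → X j ≈ Y j
  solution-unique {X} {Y} X-sol Y-sol X₀≈Y₀ X₁≈Y₁ j = proj₁ (consecutive j)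
    where
    consecutive : ∀ j → X j ≈ Y j × X (suc j) ≈ Y (suc j)
    consecutive zero    = X₀≈Y₀ , X₁≈Y₁
    consecutive (suc j) with consecutive j
    ... | Xj≈Yj , Xj+1≈Yj+1 =
      Xj+1≈Yj+1 , trans (X-sol j) (trans (+-cong (*-congˡ Xj+1≈Yj+1) (-‿cong (*-congˡ Xj≈Yj))) (sym (Y-sol j)))

  uℕ : ℕ → Carrier
  uℕ n = u p q (+ n)

  module _ (W : ℕ → Carrier) (W-solution : Solution W) where

    casoratian : ∀ n → uℕ (suc n) * W n - uℕ n * W (suc n) ≈ W 0 * q ^ℕ n
    casoratian zero    = solve 2 (λ W₀ W₁ → con (+ 1) :* W₀ :- con (+ 0) :* W₁ := W₀ :* con (+ 1)) refl (W 0) (W 1)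
    casoratian (suc n) = begin
      uℕ (suc (suc n)) * W (suc n) - uℕ (suc n) * W (suc (suc n))
        ≈⟨ +-congˡ (-‿cong (*-congˡ (W-solution n))) ⟩
      (p * uℕ (suc n) - q * uℕ n) * W (suc n) - uℕ (suc n) * (p * W (suc n) - q * W n)
        ≈⟨ solve 6 (λ p q u₁ u₀ W₁ W₀ → (p :* u₁ :- q :* u₀) :* W₁ :- u₁ :* (p :* W₁ :- q :* W₀)
                                        := q :* (u₁ :* W₀ :- u₀ :* W₁))
             refl p q (uℕ (suc n)) (uℕ n) (W (suc n)) (W n) ⟩
      q * (uℕ (suc n) * W n - uℕ n * W (suc n))
        ≈⟨ *-congˡ (casoratian n) ⟩
      q * (W 0 * q ^ℕ n)
        ≈⟨ solve 3 (λ q W₀ Q → q :* (W₀ :* Q) := W₀ :* (q :* Q)) refl q (W 0) (q ^ℕ n) ⟩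
      W 0 * q ^ℕ (suc n) ∎

    -- Both sides solve the recurrence in k, and they agree at k = 0 and (by casoratian) at k = 1.
    cross-identity : ∀ k n → uℕ (k ℕ.+ n) * W n - uℕ n * W (k ℕ.+ n) ≈ W 0 * q ^ℕ n * uℕ k
    cross-identity k n = solution-unique X-solution Y-solution X₀≈Y₀ X₁≈Y₁ k
      where
      X Y : ℕ → Carrier
      X k = uℕ (k ℕ.+ n) * W n - uℕ n * W (k ℕ.+ n)
      Y k = W 0 * q ^ℕ n * uℕ k

      X-solution : Solution X
      X-solution j = begin
        uℕ (suc (suc j) ℕ.+ n) * W n - uℕ n * W (suc (suc j) ℕ.+ n)
          ≈⟨ +-congˡ (-‿cong (*-congˡ (W-solution (j ℕ.+ n)))) ⟩
        (p * uℕ (suc j ℕ.+ n) - q * uℕ (j ℕ.+ n)) * W n - uℕ n * (p * W (suc j ℕ.+ n) - q * W (j ℕ.+ n))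
          ≈⟨ solve 8 (λ p q u₁ u₀ Wₙ uₙ W₁ W₀ → (p :* u₁ :- q :* u₀) :* Wₙ :- uₙ :* (p :* W₁ :- q :* W₀)
                                                := p :* (u₁ :* Wₙ :- uₙ :* W₁) :- q :* (u₀ :* Wₙ :- uₙ :* W₀))
               refl p q (uℕ (suc j ℕ.+ n)) (uℕ (j ℕ.+ n)) (W n) (uℕ n) (W (suc j ℕ.+ n)) (W (j ℕ.+ n)) ⟩
        p * X (suc j) - q * X j ∎

      Y-solution : Solution Y
      Y-solution j = solve 5 (λ c p q u₁ u₀ → c :* (p :* u₁ :- q :* u₀) := p :* (c :* u₁) :- q :* (c :* u₀))
                       refl (W 0 * q ^ℕ n) p q (uℕ (suc j)) (uℕ j)

      X₀≈Y₀ : X 0 ≈ Y 0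
      X₀≈Y₀ = solve 3 (λ u W c → u :* W :- u :* W := c :* con (+ 0)) refl (uℕ n) (W n) (W 0 * q ^ℕ n)

      X₁≈Y₁ : X 1 ≈ Y 1
      X₁≈Y₁ = trans (casoratian n) (sym (*-identityʳ _))

    quotient-difference : ∀ k n → ¬ (W n ≈ 0#) → ¬ (W (k ℕ.+ n) ≈ 0#) →
      W 0 * (uℕ k * (q ^ℕ n / (W n * W (k ℕ.+ n)))) ≈ uℕ (k ℕ.+ n) / W (k ℕ.+ n) - uℕ n / W n
    quotient-difference k n Wₙ≉0 Wₖ₊ₙ≉0 = begin
      W 0 * (uℕ k * (q ^ℕ n / D))
        ≈⟨ solve 4 (λ W₀ u Q D⁻¹ → W₀ :* (u :* (Q :* D⁻¹)) := W₀ :* Q :* u :* D⁻¹) refl (W 0) (uℕ k) (q ^ℕ n) (D ⁻¹) ⟩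
      (W 0 * q ^ℕ n * uℕ k) / D
        ≈⟨ *-congʳ (cross-identity k n) ⟨
      (uℕ (k ℕ.+ n) * W n - uℕ n * W (k ℕ.+ n)) / D
        ≈⟨ /-difference Wₙ≉0 Wₖ₊ₙ≉0 (uℕ (k ℕ.+ n)) (uℕ n) ⟨
      uℕ (k ℕ.+ n) / W (k ℕ.+ n) - uℕ n / W n
        ∎
      where
      D : Carrier
      D = W n * W (k ℕ.+ n)

module GeneralizedLucas {c ℓ : Level} (F : Field c ℓ) (a b p q : Field.Carrier F) where
  open Field F
  open FieldOps F
  open FieldProperties F using (x*[y/x]≈y)
  open LucasRecurrence F p q using (Solution)
  open IntegerCoefficientSolver commutativeRing using (solve; _:=_; _:-_)
  open import Relation.Binary.Reasoning.Setoid setoid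

  wℤ : ℤ → Carrier
  wℤ = w a b p q

  backward-step : ¬ (q ≈ 0#) → ∀ x y → y ≈ p * x - q * ((p * x - y) / q)
  backward-step q≉0 x y = begin
    y                               ≈⟨ solve 2 (λ px y → y := px :- (px :- y)) refl (p * x) y ⟩
    p * x - (p * x - y)             ≈⟨ +-congˡ (-‿cong (x*[y/x]≈y q≉0 (p * x - y))) ⟨
    p * x - q * ((p * x - y) / q)   ∎

  w-recurrence : ∀ n → (n ℤ.< + 0 → ¬ (q ≈ 0#)) → wℤ (n ℤ.+ + 2) ≈ p * wℤ (n ℤ.+ + 1) - q * wℤ n
  w-recurrence (+ k) _ = begin
    wℤ (+ (k ℕ.+ 2))                       ≡⟨ ≡.cong (λ m → wℤ (+ m)) (ℕP.+-comm k 2) ⟩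
    p * wℤ (+ suc k) - q * wℤ (+ k)         ≡⟨ ≡.cong (λ m → p * wℤ (+ m) - q * wℤ (+ k)) (ℕP.+-comm 1 k) ⟩
    p * wℤ (+ (k ℕ.+ 1)) - q * wℤ (+ k)     ∎
  w-recurrence -[1+ 0 ]             q≉0 = backward-step (q≉0 ℤ.-<+) a b
  w-recurrence -[1+ 1 ]             q≉0 = backward-step (q≉0 ℤ.-<+) (wℤ -[1+ 0 ]) a
  w-recurrence -[1+ suc (suc k) ]   q≉0 = backward-step (q≉0 ℤ.-<+) (wℤ -[1+ suc k ]) (wℤ -[1+ k ])

  shift-solution : ∀ t → (t ℤ.< + 0 → ¬ (q ≈ 0#)) → Solution (λ j → wℤ (t ℤ.+ + j))
  shift-solution t q≉0 j = begin
    wℤ (t ℤ.+ + suc (suc j))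
      ≡⟨ ≡.cong wℤ (shift 2) ⟩
    wℤ ((t ℤ.+ + j) ℤ.+ + 2)
      ≈⟨ w-recurrence (t ℤ.+ + j) (λ t+j<0 → q≉0 (ℤP.≤-<-trans (ℤP.i≤i+j t (+ j)) t+j<0)) ⟩
    p * wℤ ((t ℤ.+ + j) ℤ.+ + 1) - q * wℤ (t ℤ.+ + j)
      ≡⟨ ≡.cong (λ i → p * wℤ i - q * wℤ (t ℤ.+ + j)) (shift 1) ⟨
    p * wℤ (t ℤ.+ + suc j) - q * wℤ (t ℤ.+ + j)
      ∎
    where
    shift : ∀ m → t ℤ.+ + (m ℕ.+ j) ≡ (t ℤ.+ + j) ℤ.+ + m
    shift m = ≡.trans (≡.cong (λ k → t ℤ.+ + k) (ℕP.+-comm m j)) (≡.sym (ℤP.+-assoc t (+ j) (+ m)))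

index-shift : ∀ r j s → + (r ℕ.* suc j) ℤ.+ s ≡ (+ r ℤ.+ s) ℤ.+ + (r ℕ.* j)
index-shift r j s = begin
  + (r ℕ.* suc j) ℤ.+ s             ≡⟨ ≡.cong (λ k → + k ℤ.+ s) (ℕP.*-suc r j) ⟩
  (+ r ℤ.+ + (r ℕ.* j)) ℤ.+ s       ≡⟨ ℤP.+-assoc (+ r) (+ (r ℕ.* j)) s ⟩
  + r ℤ.+ (+ (r ℕ.* j) ℤ.+ s)       ≡⟨ ≡.cong (λ i → + r ℤ.+ i) (ℤP.+-comm (+ (r ℕ.* j)) s) ⟩
  + r ℤ.+ (s ℤ.+ + (r ℕ.* j))       ≡⟨ ℤP.+-assoc (+ r) s (+ (r ℕ.* j)) ⟨
  (+ r ℤ.+ s) ℤ.+ + (r ℕ.* j)       ∎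
  where open ≡.≡-Reasoning

module TelescopingTerms {c ℓ : Level} (F : Field c ℓ) (a b p q : Field.Carrier F) (r : ℕ) (s : ℤ)
  (q≉0 : (+ r ℤ.+ s) ℤ.< + 0 → ¬ (Field._≈_ F q (Field.0# F))) where
  open Field F
  open FieldOps F
  open FieldProperties F using (^ℕ-+; ^ℕ-+-even)
  open LucasRecurrence F p q using (Solution; uℕ; quotient-difference)
  open GeneralizedLucas F a b p q using (wℤ; shift-solution)
  open IntegerCoefficientSolver commutativeRing using (solve; _:=_; _:*_; _:-_)
  open import Relation.Binary.Reasoning.Setoid setoid

  W : ℕ → Carrier
  W j = wℤ ((+ r ℤ.+ s) ℤ.+ + j)

  Nonvanishing : ℕ → ℕ → Set ℓ
  Nonvanishing m n = ∀ i → 1 ≤ i → i ≤ n →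
    ¬ (wℤ (+ (r ℕ.* i) ℤ.+ s) ≈ 0#) × ¬ (wℤ (+ (r ℕ.* (i ℕ.+ m)) ℤ.+ s) ≈ 0#)

  W₀≉0 : ∀ {m n} → 1 ≤ n → Nonvanishing m n → ¬ (W 0 ≈ 0#)
  W₀≉0 1≤n nonvanishing = ≡.subst (λ i → ¬ (wℤ i ≈ 0#)) w-index (proj₁ (nonvanishing 1 ℕP.≤-refl 1≤n))
    where
    w-index : + (r ℕ.* 1) ℤ.+ s ≡ (+ r ℤ.+ s) ℤ.+ + 0
    w-index = ≡.trans (index-shift r 0 s) (≡.cong (λ k → (+ r ℤ.+ s) ℤ.+ + k) (ℕP.*-zeroʳ r))

  -- G i is u_{r(i-1)} / w_{ri+s}.
  G : ℕ → Carrier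
  G i = uℕ (r ℕ.* (i ℕ.∸ 1)) / W (r ℕ.* (i ℕ.∸ 1))

  shifted-term-telescopes : ∀ m j → ¬ (W (r ℕ.* j) ≈ 0#) → ¬ (W (r ℕ.* (j ℕ.+ m)) ≈ 0#) →
    W 0 * (uℕ (r ℕ.* m) * (q ^ℕ (r ℕ.* suc j) / (W (r ℕ.* j) * W (r ℕ.* (j ℕ.+ m)))))
      ≈ q ^ℕ r * (G (suc j ℕ.+ m) - G (suc j))
  shifted-term-telescopes m j Wₙ≉0 Wₖ₊ₙ≉0
    rewrite ℕP.*-suc r j | ≡.trans (ℕP.*-distribˡ-+ r j m) (ℕP.+-comm (r ℕ.* j) (r ℕ.* m)) = begin
    W 0 * (uℕ k * (q ^ℕ (r ℕ.+ n) / D))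
      ≈⟨ *-congˡ (*-congˡ (*-congʳ (^ℕ-+ q r n))) ⟩
    W 0 * (uℕ k * ((q ^ℕ r * q ^ℕ n) / D))
      ≈⟨ solve 5 (λ W₀ u Qr Qn D⁻¹ → W₀ :* (u :* ((Qr :* Qn) :* D⁻¹)) := Qr :* (W₀ :* (u :* (Qn :* D⁻¹))))
           refl (W 0) (uℕ k) (q ^ℕ r) (q ^ℕ n) (D ⁻¹) ⟩
    q ^ℕ r * (W 0 * (uℕ k * (q ^ℕ n / D)))
      ≈⟨ *-congˡ (quotient-difference W W-solution k n Wₙ≉0 Wₖ₊ₙ≉0) ⟩
    q ^ℕ r * (uℕ (k ℕ.+ n) / W (k ℕ.+ n) - uℕ n / W n)
      ∎
    where
    k n : ℕ
    k = r ℕ.* m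
    n = r ℕ.* j
    D : Carrier
    D = W n * W (k ℕ.+ n)
    W-solution : Solution W
    W-solution = shift-solution (+ r ℤ.+ s) q≉0

  term-telescopes : ∀ m n → Nonvanishing m n → ∀ i → 1 ≤ i → i ≤ n →
    W 0 * (uℕ (r ℕ.* m) * (q ^ℕ (r ℕ.* i) / (wℤ (+ (r ℕ.* i) ℤ.+ s) * wℤ (+ (r ℕ.* (i ℕ.+ m)) ℤ.+ s))))
      ≈ q ^ℕ r * (G (i ℕ.+ m) - G i)
  term-telescopes m n nonvanishing (suc j) 1≤i i≤n with nonvanishing (suc j) 1≤i i≤n
  ... | wᵢ≉0 , wᵢ₊ₘ≉0 rewrite index-shift r j s | index-shift r (j ℕ.+ m) s =
    shifted-term-telescopes m j wᵢ≉0 wᵢ₊ₘ≉0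

  alternating : Carrier → ℕ → Carrier
  alternating ε i = ε ^ℕ i * G i

  alternating-term-telescopes : ∀ {ε} → ε * ε ≈ 1# → ∀ m n → Nonvanishing (2 ℕ.* m) n → ∀ i → 1 ≤ i → i ≤ n →
    W 0 * (uℕ (2 ℕ.* r ℕ.* m) * ((ε ^ℕ i * q ^ℕ (r ℕ.* i))
                                  / (wℤ (+ (r ℕ.* i) ℤ.+ s) * wℤ (+ (r ℕ.* (i ℕ.+ 2 ℕ.* m)) ℤ.+ s))))
      ≈ q ^ℕ r * (alternating ε (i ℕ.+ 2 ℕ.* m) - alternating ε i)
  alternating-term-telescopes {ε} ε²≈1 m n nonvanishing i 1≤i i≤n = begin
    W 0 * (uℕ (2 ℕ.* r ℕ.* m) * ((ε ^ℕ i * Q) * D ⁻¹))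
      ≡⟨ ≡.cong (λ k → W 0 * (uℕ k * ((ε ^ℕ i * Q) * D ⁻¹))) 2rm≡r[2m] ⟩
    W 0 * (uℕ (r ℕ.* (2 ℕ.* m)) * ((ε ^ℕ i * Q) * D ⁻¹))
      ≈⟨ solve 5 (λ W₀ u e Q D⁻¹ → W₀ :* (u :* ((e :* Q) :* D⁻¹)) := e :* (W₀ :* (u :* (Q :* D⁻¹))))
           refl (W 0) (uℕ (r ℕ.* (2 ℕ.* m))) (ε ^ℕ i) Q (D ⁻¹) ⟩
    ε ^ℕ i * (W 0 * (uℕ (r ℕ.* (2 ℕ.* m)) * (Q / D)))
      ≈⟨ *-congˡ (term-telescopes (2 ℕ.* m) n nonvanishing i 1≤i i≤n) ⟩
    ε ^ℕ i * (q ^ℕ r * (G (i ℕ.+ 2 ℕ.* m) - G i))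
      ≈⟨ solve 4 (λ e c A B → e :* (c :* (A :- B)) := c :* (e :* A :- e :* B))
           refl (ε ^ℕ i) (q ^ℕ r) (G (i ℕ.+ 2 ℕ.* m)) (G i) ⟩
    q ^ℕ r * (ε ^ℕ i * G (i ℕ.+ 2 ℕ.* m) - ε ^ℕ i * G i)
      ≈⟨ *-congˡ (+-congʳ (*-congʳ (^ℕ-+-even ε²≈1 i m))) ⟨
    q ^ℕ r * (alternating ε (i ℕ.+ 2 ℕ.* m) - alternating ε i) ∎
    where
    Q D : Carrier
    Q = q ^ℕ (r ℕ.* i)
    D = wℤ (+ (r ℕ.* i) ℤ.+ s) * wℤ (+ (r ℕ.* (i ℕ.+ 2 ℕ.* m)) ℤ.+ s)
    2rm≡r[2m] : 2 ℕ.* r ℕ.* m ≡ r ℕ.* (2 ℕ.* m)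
    2rm≡r[2m] = ≡.trans (≡.cong (ℕ._* m) (ℕP.*-comm 2 r)) (ℕP.*-assoc r 2 m)

corollary7 : ∀ {c ℓ : Level} (F : Field c ℓ) →
  let open Field F
      open FieldOps F
  in (a b p q : Carrier) → ¬ (disc p q ≈ 0#) →
     (r : ℕ) (s : ℤ) (M N : ℕ) → 1 ≤ r → 1 ≤ M → 1 ≤ N →
     ((+ r ℤ.+ s) ℤ.< + 0 → ¬ (q ≈ 0#)) →
     ((∀ i → 1 ≤ i → i ≤ N →
         ¬ (w a b p q (+ (r ℕ.* i) ℤ.+ s) ≈ 0#) × ¬ (w a b p q (+ (r ℕ.* (i ℕ.+ M)) ℤ.+ s) ≈ 0#)) →
      (∀ i → 1 ≤ i → i ≤ M →
         ¬ (w a b p q (+ (r ℕ.* i) ℤ.+ s) ≈ 0#) × ¬ (w a b p q (+ (r ℕ.* (i ℕ.+ N)) ℤ.+ s) ≈ 0#)) →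
      u p q (+ (r ℕ.* M)) * sum1 N (λ i → (q ^ℕ (r ℕ.* i))
          / (w a b p q (+ (r ℕ.* i) ℤ.+ s) * w a b p q (+ (r ℕ.* (i ℕ.+ M)) ℤ.+ s)))
      ≈ u p q (+ (r ℕ.* N)) * sum1 M (λ i → (q ^ℕ (r ℕ.* i))
          / (w a b p q (+ (r ℕ.* i) ℤ.+ s) * w a b p q (+ (r ℕ.* (i ℕ.+ N)) ℤ.+ s))))
     ×
     (∀ (ε : Carrier) → (ε ≈ 1# ⊎ ε ≈ - 1#) →
      (∀ i → 1 ≤ i → i ≤ 2 ℕ.* N →
         ¬ (w a b p q (+ (r ℕ.* i) ℤ.+ s) ≈ 0#) × ¬ (w a b p q (+ (r ℕ.* (i ℕ.+ 2 ℕ.* M)) ℤ.+ s) ≈ 0#)) →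
      (∀ i → 1 ≤ i → i ≤ 2 ℕ.* M →
         ¬ (w a b p q (+ (r ℕ.* i) ℤ.+ s) ≈ 0#) × ¬ (w a b p q (+ (r ℕ.* (i ℕ.+ 2 ℕ.* N)) ℤ.+ s) ≈ 0#)) →
      u p q (+ (2 ℕ.* r ℕ.* M)) * sum1 (2 ℕ.* N) (λ i → ((ε ^ℕ i) * (q ^ℕ (r ℕ.* i)))
          / (w a b p q (+ (r ℕ.* i) ℤ.+ s) * w a b p q (+ (r ℕ.* (i ℕ.+ 2 ℕ.* M)) ℤ.+ s)))
      ≈ u p q (+ (2 ℕ.* r ℕ.* N)) * sum1 (2 ℕ.* M) (λ i → ((ε ^ℕ i) * (q ^ℕ (r ℕ.* i)))
          / (w a b p q (+ (r ℕ.* i) ℤ.+ s) * w a b p q (+ (r ℕ.* (i ℕ.+ 2 ℕ.* N)) ℤ.+ s))))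
corollary7 F a b p q _ r s M N _ _ 1≤N q≉0 =
  (λ nonvanishingᴺ nonvanishingᴹ →
     telescoping-sums-agree M N G (W₀≉0 1≤N nonvanishingᴺ)
       (term-telescopes M N nonvanishingᴺ) (term-telescopes N M nonvanishingᴹ)) ,
  (λ ε ε≈±1 nonvanishingᴺ nonvanishingᴹ →
     telescoping-sums-agree (2 ℕ.* M) (2 ℕ.* N) (alternating ε)
       (W₀≉0 (ℕP.≤-trans 1≤N (ℕP.m≤m+n N _)) nonvanishingᴺ)
       (alternating-term-telescopes (±1-square ε≈±1) M (2 ℕ.* N) nonvanishingᴺ)
       (alternating-term-telescopes (±1-square ε≈±1) N (2 ℕ.* M) nonvanishingᴹ))
  where
  open FieldProperties F using (±1-square; telescoping-sums-agree)
  open TelescopingTerms F a b p q r s q≉0
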